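{- Let $H$ be a connected hypergraph with a minimal edge cut $F$, and let $H_i$, for $i \in I$, be the connected components of $H \backslash F$. Then $H$ has an Euler tour if and only if there exists $J \subseteq I$ with $1 \le |J| \le |F|$ such that (i) $H\left[ \bigcup_{j \in J} V(H_j)\right]$ has an Euler tour, and (ii) $H_i$ is empty (has no edges) for all $i \notin J$.
   Context: A hypergraph $H=(V,E)$: non-empty finite vertex set $V$ and finite multiset $E$ of subsets of $V$ (edges). Distinct $u,v$ are adjacent via $e$ if $u,v\in e$. A walk is $v_0e_1v_1\ldots e_kv_k$ with $v_{i-1},v_i$ adjacent via $e_i$; closed if $v_0=v_k$, $k\ge2$; trail if edges are pairwise distinct. An Euler tour is a closed trail traversing every edge. Connected components are maximal connected subhypergraphs without empty edges. For $V'\subseteq V$, $H[V']$ has vertex set $V'$ and edge multiset $\{\!\{e\cap V': e\in E, e\cap V'\ne\emptyset\}\!\}$. For $F\subseteq E$, $H\backslash F=(V,E-F)$. An edge cut is a set $[S,V-S]_H=\{e\in E: e\cap S\ne\emptyset\ne e\cap(V-S)\}$ for non-empty proper $S\subset V$; minimal if it properly contains no other edge cut. -}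

module Defs where

open import Data.Nat using (ℕ; zero; suc)
open import Data.Bool using (true; false)
open import Data.Fin using (Fin)
open import Data.Fin.Subset using (Subset; _∈_; _⊆_; _⊂_; _∩_; _─_; ∁; Nonempty; Empty; inside; outside)
open import Data.Fin.Subset.Properties using (nonempty?)
open import Data.List using (List; []; _∷_; length; lookup; map; filter)
open import Data.List.Membership.Propositional using () renaming (_∈_ to _∈ₗ_)
open import Data.List.Relation.Unary.Unique.Propositional using (Unique)
open import Data.Vec using (_∷_; [])
open import Data.Product using (Σ; ∃; _×_; _,_)
open import Relation.Binary.PropositionalEquality using (_≡_; _≢_)
open import Relation.Nullary using (¬_)
open import Function.Bundles using (_⇔_)

-- A hypergraph whose vertex set is a (finite) subset V of Fin n and whose
-- edge multiset is the list E (edges are identified by their position in E).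
record Hypergraph (n : ℕ) : Set where
  constructor hg
  field
    V : Subset n
    E : List (Subset n)

open Hypergraph public

module _ {n : ℕ} where

  EdgeIdx : Hypergraph n → Set
  EdgeIdx H = Fin (length (E H))

  edge : (H : Hypergraph n) → EdgeIdx H → Subset n
  edge H i = lookup (E H) i

  WellFormed : Hypergraph n → Set
  WellFormed H = Nonempty (V H) × (∀ i → edge H i ⊆ V H)

  NoEmptyEdge : Hypergraph n → Set
  NoEmptyEdge H = ∀ i → Nonempty (edge H i)

select : ∀ {a} {A : Set a} (xs : List A) → Subset (length xs) → List A
select []       []            = []
select (x ∷ xs) (true  ∷ S)   = x ∷ select xs S
select (x ∷ xs) (false ∷ S)   = select xs S

module _ {n : ℕ} where

  data Walk (H : Hypergraph n) : Fin n → Fin n → List (EdgeIdx H) → Set where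
    trivial : ∀ {v} → v ∈ V H → Walk H v v []
    step    : ∀ {u w v es} (i : EdgeIdx H) →
              u ≢ w → u ∈ edge H i → w ∈ edge H i →
              Walk H w v es → Walk H u v (i ∷ es)

  EulerTour : Hypergraph n → Set
  EulerTour H = Σ (Fin n) λ v → Σ (List (EdgeIdx H)) λ es →
    Walk H v v es × (2 Data.Nat.≤ length es) × Unique es × (∀ i → i ∈ₗ es)

  Connected : Hypergraph n → Set
  Connected H = ∀ u v → u ∈ V H → v ∈ V H → ∃ λ es → Walk H u v es

  _∖_ : (H : Hypergraph n) → Subset (length (E H)) → Hypergraph n
  H ∖ F = hg (V H) (select (E H) (∁ F))

  _[_] : Hypergraph n → Subset n → Hypergraph n
  H [ V' ] = hg V' (map (λ e → e ∩ V') (filter (λ e → nonempty? (e ∩ V')) (E H)))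

  -- subhypergraph (V', E') of H, with E' given by a subset S of edge positions
  IsSub : (H : Hypergraph n) → Subset n → Subset (length (E H)) → Set
  IsSub H V' S = V' ⊆ V H × Nonempty V' × (∀ i → i ∈ S → edge H i ⊆ V')

  subHG : (H : Hypergraph n) → Subset n → Subset (length (E H)) → Hypergraph n
  subHG H V' S = hg V' (select (E H) S)

  ConnNoEmpty : (H : Hypergraph n) → Subset n → Subset (length (E H)) → Set
  ConnNoEmpty H V' S = IsSub H V' S × Connected (subHG H V' S) × NoEmptyEdge (subHG H V' S)

  IsComponent : (H : Hypergraph n) → Subset n → Subset (length (E H)) → Set
  IsComponent H V' S = ConnNoEmpty H V' S ×
    (∀ V'' S'' → ConnNoEmpty H V'' S'' → V' ⊆ V'' → S ⊆ S'' → V'' ≡ V' × S'' ≡ S)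

  IsEdgeCut : (H : Hypergraph n) → Subset (length (E H)) → Set
  IsEdgeCut H F = Σ (Subset n) λ S → Nonempty S × S ⊂ V H ×
    (∀ i → (i ∈ F) ⇔ (Nonempty (edge H i ∩ S) × Nonempty (edge H i ∩ (V H ─ S))))

  IsMinimalEdgeCut : (H : Hypergraph n) → Subset (length (E H)) → Set
  IsMinimalEdgeCut H F = IsEdgeCut H F × (∀ F' → IsEdgeCut H F' → ¬ (F' ⊂ F))

module Submission where

-- Every edge outside F lies inside one component of H ∖ F, so an Euler tour of H changes component
-- only along edges of F.  The components it visits are thus those it enters through an edge of F, at
-- most |F| of them, every edge of H meets their union U, and restricting each edge to U turns the tour
-- edge for edge into an Euler tour of H[U].  Conversely, minimality of F makes every edge of F meet
-- every component, and an edge outside F lies in a component, which belongs to J since the others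
-- are edgeless; so again every edge meets U and a tour of H[U] is a tour of H.

open import Defs
open import Data.Nat using (ℕ; zero; suc; _≤_; _<_; _+_; z≤n; s≤s)
open import Data.Nat.Properties using (≤-trans; ≤-antisym; ≤-<-trans; m≤n+m; +-identityʳ; +-suc; +-monoˡ-≤)
open import Data.Bool using (true; false)
import Data.Bool.Properties as Bool
open import Data.Fin using (Fin; zero; suc)
import Data.Fin.Properties as Fin
open import Data.Fin.Subset
open import Data.Fin.Subset.Properties
open import Data.Vec.Base using ([]; _∷_; here; there; tabulate)
import Data.Vec.Properties as Vec
import Data.Product.Properties as Product
open import Data.List.Base using (List; []; _∷_; length; lookup; map; filter; deduplicate)
import Data.List.Properties as List
open import Data.List.Membership.Propositional using () renaming (_∈_ to _∈ₗ_; _∉_ to _∉ₗ_)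
open import Data.List.Membership.Propositional.Properties using (∈-map⁺; ∈-map⁻; ∈-deduplicate⁺; ∈-deduplicate⁻)
import Data.List.Membership.DecPropositional as DecMembership
open import Data.List.Relation.Unary.Any using (here; there)
open import Data.List.Relation.Unary.All as All using (All; []; _∷_)
open import Data.List.Relation.Unary.All.Properties using (all-filter; tabulate⁺)
open import Data.List.Relation.Unary.AllPairs using ([]; _∷_)
open import Data.List.Relation.Unary.Unique.Propositional using (Unique)
import Data.List.Relation.Unary.Unique.Propositional.Properties as Unique
open import Data.List.Relation.Unary.Unique.DecPropositional.Properties using (deduplicate-!)
open import Data.Product using (Σ; ∃; _×_; _,_; proj₁; proj₂)
open import Data.Sum using (_⊎_; inj₁; inj₂)
open import Data.Empty using (⊥-elim)
open import Function using (_∘_)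
open import Function.Bundles using (_⇔_; mk⇔; Equivalence)
open import Relation.Binary.Definitions using (DecidableEquality)
open import Relation.Binary.PropositionalEquality using (_≡_; _≢_; refl; sym; trans; cong; subst)
open import Relation.Nullary using (¬_; yes; no; does; ¬?; _×-dec_)
open import Relation.Nullary.Decidable using (dec-true)
open import Relation.Unary using (Pred; Decidable)

module _ {a} {A : Set a} where

  ∈ₗ⇒1≤length : ∀ {x : A} {xs} → x ∈ₗ xs → 1 ≤ length xs
  ∈ₗ⇒1≤length {xs = _ ∷ _} _ = s≤s z≤n

  select-index : (xs : List A) (T : Subset (length xs)) → Fin (length (select xs T)) → Fin (length xs)
  select-index []       []          ()
  select-index (x ∷ xs) (true  ∷ T) zero    = zero
  select-index (x ∷ xs) (true  ∷ T) (suc k) = suc (select-index xs T k)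
  select-index (x ∷ xs) (false ∷ T) k       = suc (select-index xs T k)

  lookup-select : (xs : List A) (T : Subset (length xs)) (k : Fin (length (select xs T))) →
                  lookup (select xs T) k ≡ lookup xs (select-index xs T k)
  lookup-select []       []          ()
  lookup-select (x ∷ xs) (true  ∷ T) zero    = refl
  lookup-select (x ∷ xs) (true  ∷ T) (suc k) = lookup-select xs T k
  lookup-select (x ∷ xs) (false ∷ T) k       = lookup-select xs T k

  select-index-∈ : (xs : List A) (T : Subset (length xs)) (k : Fin (length (select xs T))) →
                   select-index xs T k ∈ T
  select-index-∈ []       []          ()
  select-index-∈ (x ∷ xs) (true  ∷ T) zero    = here
  select-index-∈ (x ∷ xs) (true  ∷ T) (suc k) = there (select-index-∈ xs T k)
  select-index-∈ (x ∷ xs) (false ∷ T) k       = there (select-index-∈ xs T k)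

  select-index-surjective : (xs : List A) (T : Subset (length xs)) {j : Fin (length xs)} → j ∈ T →
                            ∃ λ k → select-index xs T k ≡ j
  select-index-surjective (x ∷ xs) (true ∷ T) here = zero , refl
  select-index-surjective (x ∷ xs) (true ∷ T) (there j∈T) with select-index-surjective xs T j∈T
  ... | k , refl = suc k , refl
  select-index-surjective (x ∷ xs) (false ∷ T) (there j∈T) with select-index-surjective xs T j∈T
  ... | k , refl = k , refl

module _ {a b} {A : Set a} {B : Set b} where

  map-index : (f : A → B) (xs : List A) → Fin (length xs) → Fin (length (map f xs))
  map-index f (x ∷ xs) zero    = zero
  map-index f (x ∷ xs) (suc i) = suc (map-index f xs i)

  unmap-index : (f : A → B) (xs : List A) → Fin (length (map f xs)) → Fin (length xs)
  unmap-index f (x ∷ xs) zero    = zero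
  unmap-index f (x ∷ xs) (suc j) = suc (unmap-index f xs j)

  lookup-map-index : ∀ (f : A → B) xs i → lookup (map f xs) (map-index f xs i) ≡ f (lookup xs i)
  lookup-map-index f (x ∷ xs) zero    = refl
  lookup-map-index f (x ∷ xs) (suc i) = lookup-map-index f xs i

  lookup-map : ∀ (f : A → B) xs j → lookup (map f xs) j ≡ f (lookup xs (unmap-index f xs j))
  lookup-map f (x ∷ xs) zero    = refl
  lookup-map f (x ∷ xs) (suc j) = lookup-map f xs j

  map-index∘unmap-index : ∀ (f : A → B) xs j → map-index f xs (unmap-index f xs j) ≡ j
  map-index∘unmap-index f (x ∷ xs) zero    = refl
  map-index∘unmap-index f (x ∷ xs) (suc j) = cong suc (map-index∘unmap-index f xs j)

  unmap-index∘map-index : ∀ (f : A → B) xs i → unmap-index f xs (map-index f xs i) ≡ i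
  unmap-index∘map-index f (x ∷ xs) zero    = refl
  unmap-index∘map-index f (x ∷ xs) (suc i) = cong suc (unmap-index∘map-index f xs i)

x∈p─q⇒x∉q : ∀ {n} {x : Fin n} (p q : Subset n) → x ∈ p ─ q → x ∉ q
x∈p─q⇒x∉q (_ ∷ p) (true  ∷ q) () here
x∈p─q⇒x∉q (_ ∷ p) (false ∷ q) here ()
x∈p─q⇒x∉q (_ ∷ p) (_     ∷ q) (there x∈p─q) (there x∈q) = x∈p─q⇒x∉q p q x∈p─q x∈q

module _ {n : ℕ} where

  x∉p⇒∣p∣<∣p∪⁅x⁆∣ : ∀ {x : Fin n} {p} → x ∉ p → ∣ p ∣ < ∣ p ∪ ⁅ x ⁆ ∣
  x∉p⇒∣p∣<∣p∪⁅x⁆∣ {x} {p} x∉p =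
    ≤-<-trans (p⊆q⇒∣p∣≤∣q∣ p⊆[p∪⁅x⁆]-x) (x∈p⇒∣p-x∣<∣p∣ (q⊆p∪q p ⁅ x ⁆ (x∈⁅x⁆ x)))
    where
    p⊆[p∪⁅x⁆]-x : p ⊆ (p ∪ ⁅ x ⁆) - x
    p⊆[p∪⁅x⁆]-x y∈p = x∈p∧x≢y⇒x∈p-y (p⊆p∪q ⁅ x ⁆ y∈p) λ { refl → x∉p y∈p }

  ∈ₗ⇒⊆⋃ : ∀ {p : Subset n} {ps} → p ∈ₗ ps → p ⊆ ⋃ ps
  ∈ₗ⇒⊆⋃ {ps = p ∷ ps} (here refl) = p⊆p∪q (⋃ ps)
  ∈ₗ⇒⊆⋃ {ps = q ∷ ps} (there p∈ps) = q⊆p∪q q (⋃ ps) ∘ ∈ₗ⇒⊆⋃ p∈ps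

  x∈⋃⁻ : ∀ {x : Fin n} ps → x ∈ ⋃ ps → ∃ λ p → p ∈ₗ ps × x ∈ p
  x∈⋃⁻ [] x∈⊥ = ⊥-elim (∉⊥ x∈⊥)
  x∈⋃⁻ (p ∷ ps) x∈⋃ with x∈p∪q⁻ p (⋃ ps) x∈⋃
  ... | inj₁ x∈p = p , here refl , x∈p
  ... | inj₂ x∈⋃ps with x∈⋃⁻ ps x∈⋃ps
  ...   | q , q∈ps , x∈q = q , there q∈ps , x∈q

  Unique⇒length≤∣p∣ : ∀ (p : Subset n) {xs} → Unique xs → All (_∈ p) xs → length xs ≤ ∣ p ∣
  Unique⇒length≤∣p∣ p {[]}     _            _            = z≤n
  Unique⇒length≤∣p∣ p {x ∷ xs} (x∉xs ∷ uxs) (x∈p ∷ xs⊆p) =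
    ≤-trans (s≤s (Unique⇒length≤∣p∣ (p - x) uxs (All.zipWith ∈p-x (x∉xs , xs⊆p)))) (x∈p⇒∣p-x∣<∣p∣ x∈p)
    where
    ∈p-x : ∀ {y} → x ≢ y × y ∈ p → y ∈ p - x
    ∈p-x (x≢y , y∈p) = x∈p∧x≢y⇒x∈p-y y∈p (x≢y ∘ sym)

  ∈-tabulate-does : ∀ {ℓ} {P : Pred (Fin n) ℓ} (P? : Decidable P) i → i ∈ tabulate (does ∘ P?) ⇔ P i
  ∈-tabulate-does {P = P} P? i = mk⇔ to from
    where
    to : i ∈ tabulate (does ∘ P?) → P i
    to i∈ with P? i | trans (sym (Vec.lookup∘tabulate (does ∘ P?) i)) (Vec.[]=⇒lookup i∈)
    ... | yes Pi | _ = Pi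
    ... | no _   | ()
    from : P i → i ∈ tabulate (does ∘ P?)
    from Pi = Vec.lookup⇒[]= i _ (trans (Vec.lookup∘tabulate (does ∘ P?) i) (dec-true (P? i) Pi))

module _ {n : ℕ} {G : Hypergraph n} where

  vertices : ∀ {u v es} → Walk G u v es → List (Fin n)
  vertices (trivial {v} _)      = v ∷ []
  vertices (step {u} _ _ _ _ w) = u ∷ vertices w

  start∈vertices : ∀ {u v es} (w : Walk G u v es) → u ∈ₗ vertices w
  start∈vertices (trivial _)       = here refl
  start∈vertices (step _ _ _ _ _) = here refl

  vertices⊆V : (∀ i → edge G i ⊆ V G) → ∀ {u v es} (w : Walk G u v es) {x} → x ∈ₗ vertices w → x ∈ V G
  vertices⊆V edge⊆V (trivial v∈V)      (here refl) = v∈V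
  vertices⊆V edge⊆V (step i _ u∈i _ _) (here refl) = edge⊆V i u∈i
  vertices⊆V edge⊆V (step _ _ _ _ w)   (there x∈w) = vertices⊆V edge⊆V w x∈w

  traversed-edge-meets-vertices : ∀ {u v es} (w : Walk G u v es) {i} → i ∈ₗ es →
                                  ∃ λ x → x ∈ₗ vertices w × x ∈ edge G i
  traversed-edge-meets-vertices (step _ _ u∈i _ _) (here refl) = _ , here refl , u∈i
  traversed-edge-meets-vertices (step _ _ _ _ w)   (there i∈es) with traversed-edge-meets-vertices w i∈es
  ... | x , x∈w , x∈i = x , there x∈w , x∈i

TourEdges : ∀ {m} → List (Fin m) → Set
TourEdges es = 2 ≤ length es × Unique es × (∀ i → i ∈ₗ es)

TourEdges-map : ∀ {m m′} (f : Fin m → Fin m′) (g : Fin m′ → Fin m) →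
                (∀ j → f (g j) ≡ j) → (∀ i → g (f i) ≡ i) → ∀ {es} → TourEdges es → TourEdges (map f es)
TourEdges-map f g f∘g g∘f {es} (2≤len , unique , covers) =
  subst (2 ≤_) (sym (List.length-map f es)) 2≤len ,
  Unique.map⁺ (λ {i} {i′} fi≡fi′ → trans (sym (g∘f i)) (trans (cong g fi≡fi′) (g∘f i′))) unique ,
  λ j → subst (_∈ₗ map f es) (f∘g j) (∈-map⁺ f (covers (g j)))

module _ {n : ℕ} (H : Hypergraph n) (U : Subset n) where

  private
    restrict : Subset n → Subset n
    restrict e = e ∩ U

    ι : Fin (length (E H)) → Fin (length (map restrict (E H)))
    ι = map-index restrict (E H)

    κ : Fin (length (map restrict (E H))) → Fin (length (E H))
    κ = unmap-index restrict (E H)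

  restrict-all-meet : (∀ i → Nonempty (edge H i ∩ U)) → H [ U ] ≡ hg U (map restrict (E H))
  restrict-all-meet meets =
    cong (λ Es → hg U (map restrict Es))
         (List.filter-all (λ e → nonempty? (e ∩ U)) (subst (All _) (List.tabulate-lookup (E H)) (tabulate⁺ meets)))

  walk-restrict : ∀ {u v es} (w : Walk H u v es) → (∀ {x} → x ∈ₗ vertices w → x ∈ U) →
                  Walk (hg U (map restrict (E H))) u v (map ι es)
  walk-restrict (trivial _)            ⊆U = trivial (⊆U (here refl))
  walk-restrict (step i u≢w u∈i w∈i w) ⊆U =
    step (ι i) u≢w (restricted (x∈p∩q⁺ (u∈i , ⊆U (here refl))))
                   (restricted (x∈p∩q⁺ (w∈i , ⊆U (there (start∈vertices w)))))
                   (walk-restrict w (⊆U ∘ there))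
    where
    restricted : ∀ {x} → x ∈ restrict (lookup (E H) i) → x ∈ lookup (map restrict (E H)) (ι i)
    restricted {x} = subst (x ∈_) (sym (lookup-map-index restrict (E H) i))

  walk-unrestrict : U ⊆ V H → ∀ {u v es} → Walk (hg U (map restrict (E H))) u v es → Walk H u v (map κ es)
  walk-unrestrict U⊆V (trivial v∈U)          = trivial (U⊆V v∈U)
  walk-unrestrict U⊆V (step j u≢w u∈j w∈j w) =
    step (κ j) u≢w (unrestricted u∈j) (unrestricted w∈j) (walk-unrestrict U⊆V w)
    where
    unrestricted : ∀ {x} → x ∈ lookup (map restrict (E H)) j → x ∈ lookup (E H) (κ j)
    unrestricted {x} x∈j = proj₁ (x∈p∩q⁻ _ U (subst (x ∈_) (lookup-map restrict (E H) j) x∈j))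

  tour-restrict : ∀ {v es} (w : Walk H v v es) → TourEdges es → (∀ {x} → x ∈ₗ vertices w → x ∈ U) →
                  EulerTour (H [ U ])
  tour-restrict {v} {es} w tour ⊆U =
    subst EulerTour (sym (restrict-all-meet meets))
          (v , map ι es , walk-restrict w ⊆U ,
           TourEdges-map ι κ (map-index∘unmap-index restrict (E H)) (unmap-index∘map-index restrict (E H)) tour)
    where
    meets : ∀ i → Nonempty (edge H i ∩ U)
    meets i with traversed-edge-meets-vertices w (proj₂ (proj₂ tour) i)
    ... | x , x∈w , x∈i = x , x∈p∩q⁺ (x∈i , ⊆U x∈w)

  tour-unrestrict : U ⊆ V H → (∀ i → Nonempty (edge H i ∩ U)) → EulerTour (H [ U ]) → EulerTour H
  tour-unrestrict U⊆V meets tour with subst EulerTour (restrict-all-meet meets) tour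
  ... | v , es , w , tour-es =
    v , map κ es , walk-unrestrict U⊆V w ,
    TourEdges-map κ ι (unmap-index∘map-index restrict (E H)) (map-index∘unmap-index restrict (E H)) tour-es

module _ {n : ℕ} {H : Hypergraph n} (F : Subset (length (E H))) where

  F-targets : ∀ {u v es} → Walk H u v es → List (Fin n)
  F-targets (trivial _) = []
  F-targets (step {w = w} i _ _ _ p) with i ∈? F
  ... | yes _ = w ∷ F-targets p
  ... | no  _ = F-targets p

  length-F-targets : ∀ {u v es} (w : Walk H u v es) → length (F-targets w) ≡ length (filter (_∈? F) es)
  length-F-targets (trivial _) = refl
  length-F-targets (step i _ _ _ p) with i ∈? F
  ... | yes _ = cong suc (length-F-targets p)
  ... | no  _ = length-F-targets p

  F-targets⊆vertices : ∀ {u v es} (w : Walk H u v es) {x} → x ∈ₗ F-targets w → x ∈ₗ vertices w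
  F-targets⊆vertices (step i _ _ _ p) x∈ with i ∈? F | x∈
  ... | yes _ | here refl = there (start∈vertices p)
  ... | yes _ | there x∈p = there (F-targets⊆vertices p x∈p)
  ... | no  _ | x∈p       = there (F-targets⊆vertices p x∈p)

  F-targets-nonempty : ∀ {u v es} (w : Walk H u v es) {i} → i ∈ F → i ∈ₗ es → F-targets w ≢ []
  F-targets-nonempty (step j _ _ _ p) i∈F i∈es with j ∈? F | i∈es
  ... | yes _   | _           = λ ()
  ... | no  j∉F | here refl   = ⊥-elim (j∉F i∈F)
  ... | no  _   | there i∈es′ = F-targets-nonempty p i∈F i∈es′

module _ {n : ℕ} where

  -- A walk of hg U (select Es S) whose edges are named by their positions in Es, so that S can grow.
  data SubWalk (Es : List (Subset n)) (S : Subset (length Es)) (U : Subset n) : Fin n → Fin n → Set where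
    stop : ∀ {v} → v ∈ U → SubWalk Es S U v v
    hop  : ∀ {u w v} j → j ∈ S → u ≢ w → u ∈ lookup Es j → w ∈ lookup Es j →
           SubWalk Es S U w v → SubWalk Es S U u v

  ConnectedIn : (Es : List (Subset n)) → Subset (length Es) → Subset n → Set
  ConnectedIn Es S U = ∀ u v → u ∈ U → v ∈ U → SubWalk Es S U u v

  module _ {Es : List (Subset n)} where

    _++ʷ_ : ∀ {S U u v w} → SubWalk Es S U u v → SubWalk Es S U v w → SubWalk Es S U u w
    stop _                ++ʷ q = q
    hop j j∈S u≢w u∈ w∈ p ++ʷ q = hop j j∈S u≢w u∈ w∈ (p ++ʷ q)

    SubWalk-mono : ∀ {S S′ U U′ u v} → S ⊆ S′ → U ⊆ U′ → SubWalk Es S U u v → SubWalk Es S′ U′ u v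
    SubWalk-mono S⊆ U⊆ (stop v∈U)              = stop (U⊆ v∈U)
    SubWalk-mono S⊆ U⊆ (hop j j∈S u≢w u∈ w∈ p) = hop j (S⊆ j∈S) u≢w u∈ w∈ (SubWalk-mono S⊆ U⊆ p)

    connectedIn-extend : ∀ {S C c k} → ConnectedIn Es S C → c ∈ C → c ∈ lookup Es k →
                         ConnectedIn Es (S ∪ ⁅ k ⁆) (C ∪ lookup Es k)
    connectedIn-extend {S} {C} {c} {k} conn c∈C c∈k u v u∈ v∈ = to-c u u∈ ++ʷ from-c v v∈
      where
      k∈S′ : k ∈ S ∪ ⁅ k ⁆
      k∈S′ = q⊆p∪q S ⁅ k ⁆ (x∈⁅x⁆ k)
      c∈C′ : c ∈ C ∪ lookup Es k
      c∈C′ = p⊆p∪q (lookup Es k) c∈C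
      lift : ∀ {x y} → SubWalk Es S C x y → SubWalk Es (S ∪ ⁅ k ⁆) (C ∪ lookup Es k) x y
      lift = SubWalk-mono (p⊆p∪q ⁅ k ⁆) (p⊆p∪q (lookup Es k))
      to-c : ∀ x → x ∈ C ∪ lookup Es k → SubWalk Es (S ∪ ⁅ k ⁆) (C ∪ lookup Es k) x c
      to-c x x∈ with x∈p∪q⁻ C _ x∈
      ... | inj₁ x∈C = lift (conn x c x∈C c∈C)
      ... | inj₂ x∈k with x Fin.≟ c
      ...   | yes refl = stop c∈C′
      ...   | no x≢c   = hop k k∈S′ x≢c x∈k c∈k (stop c∈C′)
      from-c : ∀ y → y ∈ C ∪ lookup Es k → SubWalk Es (S ∪ ⁅ k ⁆) (C ∪ lookup Es k) c y
      from-c y y∈ with x∈p∪q⁻ C _ y∈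
      ... | inj₁ y∈C = lift (conn c y c∈C y∈C)
      ... | inj₂ y∈k with c Fin.≟ y
      ...   | yes refl = stop c∈C′
      ...   | no c≢y   = hop k k∈S′ c≢y c∈k y∈k (stop y∈)

  module _ (G : Hypergraph n) (C : Subset n) (S : Subset (length (E G))) where

    walk⇒subWalk : ∀ {u v es} → Walk (subHG G C S) u v es → SubWalk (E G) S C u v
    walk⇒subWalk (trivial v∈C)          = stop v∈C
    walk⇒subWalk (step i u≢w u∈i w∈i w) =
      hop (select-index (E G) S i) (select-index-∈ (E G) S i) u≢w
          (subst (_ ∈_) (lookup-select (E G) S i) u∈i) (subst (_ ∈_) (lookup-select (E G) S i) w∈i)
          (walk⇒subWalk w)

    subWalk⇒walk : ∀ {u v} → SubWalk (E G) S C u v → ∃ λ es → Walk (subHG G C S) u v es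
    subWalk⇒walk (stop v∈C) = [] , trivial v∈C
    subWalk⇒walk (hop j j∈S u≢w u∈j w∈j p) with select-index-surjective (E G) S j∈S | subWalk⇒walk p
    ... | i , i↦j | es , w = i ∷ es , step i u≢w (edge-i u∈j) (edge-i w∈j) w
      where
      edge-i : ∀ {x} → x ∈ lookup (E G) j → x ∈ lookup (select (E G) S) i
      edge-i = subst (_ ∈_) (sym (trans (lookup-select (E G) S i) (cong (lookup (E G)) i↦j)))

    connected⇔connectedIn : Connected (subHG G C S) ⇔ ConnectedIn (E G) S C
    connected⇔connectedIn = mk⇔ (λ conn u v u∈ v∈ → walk⇒subWalk (proj₂ (conn u v u∈ v∈)))
                                (λ conn u v u∈ v∈ → subWalk⇒walk (conn u v u∈ v∈))

module Components {n : ℕ} (G : Hypergraph n) (edge⊆V : ∀ i → edge G i ⊆ V G) (noEmpty : NoEmptyEdge G) where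

  private
    m = length (E G)

  ConnectedSub : Subset n → Subset m → Set
  ConnectedSub C S = IsSub G C S × ConnectedIn (E G) S C

  connNoEmpty⇔connectedSub : ∀ {C S} → ConnNoEmpty G C S ⇔ ConnectedSub C S
  connNoEmpty⇔connectedSub {C} {S} = mk⇔
    (λ (sub , conn , _) → sub , Equivalence.to (connected⇔connectedIn G C S) conn)
    (λ (sub , conn) → sub , Equivalence.from (connected⇔connectedIn G C S) conn ,
                      λ k → subst Nonempty (sym (lookup-select (E G) S k)) (noEmpty _))

  IsSub-extend : ∀ {C S} k → IsSub G C S → IsSub G (C ∪ edge G k) (S ∪ ⁅ k ⁆)
  IsSub-extend {C} {S} k (C⊆V , (x , x∈C) , S⊆C) = C∪k⊆V , (x , p⊆p∪q _ x∈C) , S∪k⊆C∪k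
    where
    C∪k⊆V : C ∪ edge G k ⊆ V G
    C∪k⊆V x∈ with x∈p∪q⁻ C _ x∈
    ... | inj₁ x∈C = C⊆V x∈C
    ... | inj₂ x∈k = edge⊆V k x∈k
    S∪k⊆C∪k : ∀ i → i ∈ S ∪ ⁅ k ⁆ → edge G i ⊆ C ∪ edge G k
    S∪k⊆C∪k i i∈ x∈i with x∈p∪q⁻ S _ i∈
    ... | inj₁ i∈S = p⊆p∪q _ (S⊆C i i∈S x∈i)
    ... | inj₂ i∈k with x∈⁅y⁆⇒x≡y k i∈k
    ...   | refl = q⊆p∪q C _ x∈i

  connectedSub-extend : ∀ {C S} k → ConnectedSub C S → Nonempty (edge G k ∩ C) →
                        ConnectedSub (C ∪ edge G k) (S ∪ ⁅ k ⁆)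
  connectedSub-extend {C} k (sub , conn) (c , c∈k∩C) =
    IsSub-extend k sub , connectedIn-extend conn (proj₂ c∈k,C) (proj₁ c∈k,C)
    where
    c∈k,C : c ∈ edge G k × c ∈ C
    c∈k,C = x∈p∩q⁻ _ _ c∈k∩C

  module _ {C S} (comp : IsComponent G C S) where

    component-edge⊆ : ∀ {k} → k ∈ S → edge G k ⊆ C
    component-edge⊆ {k} = proj₂ (proj₂ (proj₁ (proj₁ comp))) k

    component⊆V : C ⊆ V G
    component⊆V = proj₁ (proj₁ (proj₁ comp))

    component-absorbs : ∀ k → Nonempty (edge G k ∩ C) → k ∈ S
    component-absorbs k k∩C with proj₂ comp _ _ extension (p⊆p∪q _) (p⊆p∪q _)
      where
      extension : ConnNoEmpty G (C ∪ edge G k) (S ∪ ⁅ k ⁆)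
      extension = Equivalence.from connNoEmpty⇔connectedSub
                    (connectedSub-extend k (Equivalence.to connNoEmpty⇔connectedSub (proj₁ comp)) k∩C)
    ... | _ , S∪k≡S = subst (k ∈_) S∪k≡S (q⊆p∪q S _ (x∈⁅x⁆ k))

  Outgoing : Subset n → Subset m → Fin m → Set
  Outgoing C S k = k ∉ S × Nonempty (edge G k ∩ C)

  outgoing? : ∀ C S → Decidable (Outgoing C S)
  outgoing? C S k = ¬? (k ∈? S) ×-dec nonempty? (edge G k ∩ C)

  Saturated : Subset n × Subset m → Set
  Saturated (C , S) = ∀ k → ¬ Outgoing C S k

  grow : ℕ → Subset n → Subset m → Subset n × Subset m
  grow zero       C S = C , S
  grow (suc fuel) C S with Fin.any? (outgoing? C S)
  ... | yes (k , _) = grow fuel (C ∪ edge G k) (S ∪ ⁅ k ⁆)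
  ... | no  _       = C , S

  grow-preserves : (P : Subset n → Subset m → Set) →
                   (∀ {C S} k → Outgoing C S k → P C S → P (C ∪ edge G k) (S ∪ ⁅ k ⁆)) →
                   ∀ fuel {C S} → P C S → P (proj₁ (grow fuel C S)) (proj₂ (grow fuel C S))
  grow-preserves P extend zero       PCS = PCS
  grow-preserves P extend (suc fuel) {C} {S} PCS with Fin.any? (outgoing? C S)
  ... | yes (k , out) = grow-preserves P extend fuel (extend k out PCS)
  ... | no  _         = PCS

  grow-saturated : ∀ fuel C S → m ≤ ∣ S ∣ + fuel → Saturated (grow fuel C S)
  grow-saturated zero C S m≤∣S∣ k (k∉S , _) = k∉S (subst (k ∈_) (sym S≡⊤) ∈⊤)
    where
    S≡⊤ : S ≡ ⊤
    S≡⊤ = ∣p∣≡n⇒p≡⊤ (≤-antisym (∣p∣≤n S) (subst (m ≤_) (+-identityʳ _) m≤∣S∣))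
  grow-saturated (suc fuel) C S m≤ with Fin.any? (outgoing? C S)
  ... | yes (k , k∉S , _) = grow-saturated fuel _ _
          (≤-trans m≤ (subst (_≤ ∣ S ∪ ⁅ k ⁆ ∣ + fuel) (sym (+-suc ∣ S ∣ fuel))
                          (+-monoˡ-≤ fuel (x∉p⇒∣p∣<∣p∪⁅x⁆∣ k∉S))))
  ... | no none = λ k out → none (k , out)

  -- m rounds suffice because each round adds a new edge to S.
  component : Fin n → Subset n × Subset m
  component x = grow m ⁅ x ⁆ ⊥

  component-saturated : ∀ x → Saturated (component x)
  component-saturated x = grow-saturated m ⁅ x ⁆ ⊥ (m≤n+m m _)

  x∈component : ∀ x → x ∈ proj₁ (component x)
  x∈component x = grow-preserves (λ C _ → x ∈ C) (λ k _ → p⊆p∪q _) m (x∈⁅x⁆ x)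

  component-connectedSub : ∀ {x} → x ∈ V G → ConnectedSub (proj₁ (component x)) (proj₂ (component x))
  component-connectedSub {x} x∈V =
    grow-preserves ConnectedSub (λ k (_ , k∩C) CS → connectedSub-extend k CS k∩C) m singleton
    where
    singleton : ConnectedSub ⁅ x ⁆ ⊥
    singleton = ((λ y∈ → subst (_∈ V G) (sym (x∈⁅y⁆⇒x≡y x y∈)) x∈V) , (x , x∈⁅x⁆ x) ,
                 (λ _ i∈⊥ → ⊥-elim (∉⊥ i∈⊥))) ,
                λ u v u∈ v∈ → subst (λ z → SubWalk (E G) ⊥ ⁅ x ⁆ z v)
                                    (trans (x∈⁅y⁆⇒x≡y x v∈) (sym (x∈⁅y⁆⇒x≡y x u∈))) (stop v∈)

  saturated-closed : ∀ {C S S′ U u v} → IsSub G C S → Saturated (C , S) →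
                     SubWalk (E G) S′ U u v → u ∈ C → v ∈ C
  saturated-closed sub sat (stop _) u∈C = u∈C
  saturated-closed {S = S} sub sat (hop j _ _ u∈j w∈j p) u∈C with j ∈? S
  ... | yes j∈S = saturated-closed sub sat p (proj₂ (proj₂ sub) j j∈S w∈j)
  ... | no  j∉S = ⊥-elim (sat j (j∉S , _ , x∈p∩q⁺ (u∈j , u∈C)))

  component-maximal : ∀ {x} → x ∈ V G → ∀ C S → ConnNoEmpty G C S →
                      proj₁ (component x) ⊆ C → proj₂ (component x) ⊆ S →
                      C ≡ proj₁ (component x) × S ≡ proj₂ (component x)
  component-maximal {x} x∈V C S CS Cx⊆C Sx⊆S = ⊆-antisym C⊆Cx Cx⊆C , ⊆-antisym S⊆Sx Sx⊆S
    where
    sub = proj₁ (component-connectedSub x∈V)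
    sat = component-saturated x
    conn = proj₂ (Equivalence.to connNoEmpty⇔connectedSub CS)
    C⊆Cx : C ⊆ proj₁ (component x)
    C⊆Cx {y} y∈C = saturated-closed sub sat (conn x y (Cx⊆C (x∈component x)) y∈C) (x∈component x)
    S⊆Sx : S ⊆ proj₂ (component x)
    S⊆Sx {j} j∈S with j ∈? proj₂ (component x) | noEmpty j
    ... | yes j∈Sx | _       = j∈Sx
    ... | no  j∉Sx | z , z∈j =
      ⊥-elim (sat j (j∉Sx , z , x∈p∩q⁺ (z∈j , C⊆Cx (proj₂ (proj₂ (proj₁ CS)) j j∈S z∈j))))

  component-isComponent : ∀ {x} → x ∈ V G → IsComponent G (proj₁ (component x)) (proj₂ (component x))
  component-isComponent x∈V =
    Equivalence.from connNoEmpty⇔connectedSub (component-connectedSub x∈V) , component-maximal x∈V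

  component-unique : ∀ {C S x} → IsComponent G C S → x ∈ C → (C , S) ≡ component x
  component-unique {C} {S} {x} comp x∈C
    with grow-preserves (λ C′ S′ → C′ ⊆ C × S′ ⊆ S) absorb m
           ((λ y∈ → subst (_∈ C) (sym (x∈⁅y⁆⇒x≡y x y∈)) x∈C) , (λ i∈⊥ → ⊥-elim (∉⊥ i∈⊥)))
    where
    absorb : ∀ {C′ S′} k → Outgoing C′ S′ k → C′ ⊆ C × S′ ⊆ S →
             C′ ∪ edge G k ⊆ C × S′ ∪ ⁅ k ⁆ ⊆ S
    absorb {C′} {S′} k (_ , z , z∈k∩C′) (C′⊆C , S′⊆S) = C′∪k⊆C , S′∪k⊆S
      where
      k∈S : k ∈ S
      k∈S with x∈p∩q⁻ _ _ z∈k∩C′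
      ... | z∈k , z∈C′ = component-absorbs comp k (z , x∈p∩q⁺ (z∈k , C′⊆C z∈C′))
      C′∪k⊆C : C′ ∪ edge G k ⊆ C
      C′∪k⊆C y∈ with x∈p∪q⁻ C′ _ y∈
      ... | inj₁ y∈C′ = C′⊆C y∈C′
      ... | inj₂ y∈k  = component-edge⊆ comp k∈S y∈k
      S′∪k⊆S : S′ ∪ ⁅ k ⁆ ⊆ S
      S′∪k⊆S i∈ with x∈p∪q⁻ S′ _ i∈
      ... | inj₁ i∈S′ = S′⊆S i∈S′
      ... | inj₂ i∈k  = subst (_∈ S) (sym (x∈⁅y⁆⇒x≡y k i∈k)) k∈S
  ... | Cx⊆C , Sx⊆S with component-maximal (component⊆V comp x∈C) C S (proj₁ comp) Cx⊆C Sx⊆S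
  ...   | refl , refl = refl

  component-≡-on-edge : ∀ k {u w} → u ∈ edge G k → w ∈ edge G k → component u ≡ component w
  component-≡-on-edge k {u} {w} u∈k w∈k = component-unique comp (component-edge⊆ comp k∈Su w∈k)
    where
    comp : IsComponent G (proj₁ (component u)) (proj₂ (component u))
    comp = component-isComponent (edge⊆V k u∈k)
    k∈Su : k ∈ proj₂ (component u)
    k∈Su = component-absorbs comp k (u , x∈p∩q⁺ (u∈k , x∈component u))

edge-cut-nonempty : ∀ {n} (H : Hypergraph n) {F} → WellFormed H → Connected H → IsEdgeCut H F → Nonempty F
edge-cut-nonempty H {F} wf conn (S , (x , x∈S) , (S⊆V , y , y∈V , y∉S) , crossing⇔) =
  leaves (proj₂ (conn x y (S⊆V x∈S) y∈V)) x∈S y∉S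
  where
  leaves : ∀ {u v es} → Walk H u v es → u ∈ S → v ∉ S → Nonempty F
  leaves (trivial _) u∈S v∉S = ⊥-elim (v∉S u∈S)
  leaves {u} (step {w = w} i _ u∈i w∈i p) u∈S v∉S with w ∈? S
  ... | yes w∈S = leaves p w∈S v∉S
  ... | no  w∉S = i , Equivalence.from (crossing⇔ i)
                        ((u , x∈p∩q⁺ (u∈i , u∈S)) ,
                         (w , x∈p∩q⁺ (w∈i , x∈p∧x∉q⇒x∈p─q (proj₂ wf i w∈i) w∉S)))

module CutComponents {n : ℕ} (H : Hypergraph n) (F : Subset (length (E H)))
                     (wf : WellFormed H) (noEmpty : NoEmptyEdge H) where

  edge-∖ : ∀ k → edge (H ∖ F) k ≡ edge H (select-index (E H) (∁ F) k)
  edge-∖ = lookup-select (E H) (∁ F)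

  open Components (H ∖ F) (λ k x∈ → proj₂ wf _ (subst (_ ∈_) (edge-∖ k) x∈))
                  (λ k → subst Nonempty (sym (edge-∖ k)) (noEmpty _)) public

  outside-F : ∀ {i} → i ∉ F → ∃ λ k → select-index (E H) (∁ F) k ≡ i
  outside-F i∉F = select-index-surjective (E H) (∁ F) (x∉p⇒x∈∁p i∉F)

  outside-F∈component : ∀ {C S i x} → IsComponent (H ∖ F) C S → i ∉ F → x ∈ edge H i → x ∈ C →
                        ∃ λ k → select-index (E H) (∁ F) k ≡ i × k ∈ S
  outside-F∈component comp i∉F x∈i x∈C with outside-F i∉F
  ... | k , refl = k , refl , component-absorbs comp k (_ , x∈p∩q⁺ (subst (_ ∈_) (sym (edge-∖ k)) x∈i , x∈C))

  component-edges-nonempty : ∀ {i y} → i ∉ F → y ∈ edge H i → Nonempty (proj₂ (component y))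
  component-edges-nonempty {i} {y} i∉F y∈i
    with outside-F∈component (component-isComponent (proj₂ wf i y∈i)) i∉F y∈i (x∈component y)
  ... | k , _ , k∈S = k , k∈S

  component-≡-on-edge∉F : ∀ {i u w} → i ∉ F → u ∈ edge H i → w ∈ edge H i → component u ≡ component w
  component-≡-on-edge∉F i∉F u∈i w∈i with outside-F i∉F
  ... | k , refl = component-≡-on-edge k (subst (_ ∈_) (sym (edge-∖ k)) u∈i) (subst (_ ∈_) (sym (edge-∖ k)) w∈i)

  Crossing : Subset n → Fin (length (E H)) → Set
  Crossing C i = Nonempty (edge H i ∩ C) × Nonempty (edge H i ∩ (V H ─ C))

  crossing? : ∀ C → Decidable (Crossing C)
  crossing? C i = nonempty? (edge H i ∩ C) ×-dec nonempty? (edge H i ∩ (V H ─ C))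

  cut : Subset n → Subset (length (E H))
  cut C = tabulate (does ∘ crossing? C)

  ∈cut⇔ : ∀ C i → i ∈ cut C ⇔ Crossing C i
  ∈cut⇔ C = ∈-tabulate-does (crossing? C)

  component-cut⊆F : ∀ {C S} → IsComponent (H ∖ F) C S → cut C ⊆ F
  component-cut⊆F {C} comp {i} i∈cut with i ∈? F
  ... | yes i∈F = i∈F
  ... | no  i∉F with Equivalence.to (∈cut⇔ C i) i∈cut
  ...   | (x , x∈i∩C) , (y , y∈i∩V─C) with x∈p∩q⁻ _ _ x∈i∩C | x∈p∩q⁻ _ _ y∈i∩V─C
  ...     | x∈i , x∈C | y∈i , y∈V─C with outside-F∈component comp i∉F x∈i x∈C
  ...       | k , refl , k∈S =
    ⊥-elim (x∈p─q⇒x∉q (V H) C y∈V─C (component-edge⊆ comp k∈S (subst (_ ∈_) (sym (edge-∖ k)) y∈i)))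

  -- If g ∈ F missed C, the edges leaving C would form an edge cut inside F without g.
  minimal-cut-meets-components : IsMinimalEdgeCut H F → ∀ {C S} → IsComponent (H ∖ F) C S →
                                 ∀ {g} → g ∈ F → Nonempty (edge H g ∩ C)
  minimal-cut-meets-components (_ , minimal) {C} comp {g} g∈F with nonempty? (edge H g ∩ C)
  ... | yes g∩C = g∩C
  ... | no  g∩C=∅ = ⊥-elim (minimal (cut C) cut-C (component-cut⊆F comp , g , g∈F , g∉cut))
    where
    y = proj₁ (noEmpty g)
    y∈g = proj₂ (noEmpty g)
    sub = proj₁ (proj₁ comp)
    cut-C : IsEdgeCut H (cut C)
    cut-C = C , proj₁ (proj₂ sub) ,
            (proj₁ sub , y , proj₂ wf g y∈g , λ y∈C → g∩C=∅ (y , x∈p∩q⁺ (y∈g , y∈C))) , ∈cut⇔ C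
    g∉cut : g ∉ cut C
    g∉cut g∈cut = g∩C=∅ (proj₁ (Equivalence.to (∈cut⇔ C g) g∈cut))

  Component : Set
  Component = Subset n × Subset (length (E (H ∖ F)))

  _≟ᶜ_ : DecidableEquality Component
  _≟ᶜ_ = Product.≡-dec (Vec.≡-dec Bool._≟_) (Vec.≡-dec Bool._≟_)

  entered-components : ∀ {u v es} → Walk H u v es → List Component
  entered-components w = map component (F-targets F w)

  component-end : ∀ {u v es} (w : Walk H u v es) →
                  (F-targets F w ≡ [] × component v ≡ component u) ⊎ component v ∈ₗ entered-components w
  component-end (trivial _) = inj₁ (refl , refl)
  component-end (step i _ u∈i w∈i p) with i ∈? F | component-end p
  ... | yes _   | inj₁ (_ , v~w)    = inj₂ (here v~w)
  ... | yes _   | inj₂ v∈p          = inj₂ (there v∈p)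
  ... | no  i∉F | inj₁ (none , v~w) = inj₁ (none , trans v~w (sym (component-≡-on-edge∉F i∉F u∈i w∈i)))
  ... | no  _   | inj₂ v∈p          = inj₂ v∈p

  component-vertex : ∀ {u v es} (w : Walk H u v es) {x} → x ∈ₗ vertices w →
                     component x ∈ₗ entered-components w ⊎ component x ≡ component u
  component-vertex (trivial _)          (here refl) = inj₂ refl
  component-vertex (step _ _ _ _ _)     (here refl) = inj₂ refl
  component-vertex (step i _ u∈i w∈i p) (there x∈p) with i ∈? F | component-vertex p x∈p
  ... | yes _   | inj₁ x∈p′ = inj₁ (there x∈p′)
  ... | yes _   | inj₂ x~w  = inj₁ (here x~w)
  ... | no  _   | inj₁ x∈p′ = inj₁ x∈p′
  ... | no  i∉F | inj₂ x~w  = inj₂ (trans x~w (sym (component-≡-on-edge∉F i∉F u∈i w∈i)))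

  tour-vertices-entered : Nonempty F → ∀ {v es} (w : Walk H v v es) → TourEdges es →
                          ∀ {x} → x ∈ₗ vertices w → component x ∈ₗ entered-components w
  tour-vertices-entered (g , g∈F) w (_ , _ , covers) x∈w with component-vertex w x∈w | component-end w
  ... | inj₁ x∈  | _               = x∈
  ... | inj₂ x~v | inj₂ v∈         = subst (_∈ₗ entered-components w) (sym x~v) v∈
  ... | inj₂ _   | inj₁ (none , _) = ⊥-elim (F-targets-nonempty F w g∈F (covers g) none)

  TourComponents : List Component → Set
  TourComponents J =
    Unique J × All (λ c → IsComponent (H ∖ F) (proj₁ c) (proj₂ c)) J ×
    1 ≤ length J × length J ≤ ∣ F ∣ ×
    EulerTour (H [ ⋃ (map proj₁ J) ]) ×
    (∀ C S → IsComponent (H ∖ F) C S → (C , S) ∉ₗ J → Empty S)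

  tour⇒tourComponents : Connected H → IsEdgeCut H F → EulerTour H → ∃ TourComponents
  tour⇒tourComponents conn cutF (v , es , w , tour@(_ , unique , covers)) =
    J , deduplicate-! _≟ᶜ_ (entered-components w) , All.tabulate J-components ,
    ∈ₗ⇒1≤length (vertex∈J (start∈vertices w)) , |J|≤|F| ,
    tour-restrict H (⋃ (map proj₁ J)) w tour vertex∈⋃J , others-empty
    where
    J = deduplicate _≟ᶜ_ (entered-components w)
    vertex∈J : ∀ {x} → x ∈ₗ vertices w → component x ∈ₗ J
    vertex∈J = ∈-deduplicate⁺ _≟ᶜ_ ∘ tour-vertices-entered (edge-cut-nonempty H wf conn cutF) w tour
    vertex∈⋃J : ∀ {x} → x ∈ₗ vertices w → x ∈ ⋃ (map proj₁ J)
    vertex∈⋃J {x} x∈w = ∈ₗ⇒⊆⋃ (∈-map⁺ proj₁ (vertex∈J x∈w)) (x∈component x)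
    |J|≤|F| : length J ≤ ∣ F ∣
    |J|≤|F| = ≤-trans (List.length-deduplicate _≟ᶜ_ (entered-components w))
                (subst (_≤ ∣ F ∣) (sym (trans (List.length-map component (F-targets F w)) (length-F-targets F w)))
                  (Unique⇒length≤∣p∣ F (Unique.filter⁺ (_∈? F) unique) (all-filter (_∈? F) es)))
    J-components : ∀ {c} → c ∈ₗ J → IsComponent (H ∖ F) (proj₁ c) (proj₂ c)
    J-components c∈J with ∈-map⁻ component (∈-deduplicate⁻ _≟ᶜ_ (entered-components w) c∈J)
    ... | x , x∈ , refl = component-isComponent (vertices⊆V (proj₂ wf) w (F-targets⊆vertices F w x∈))
    others-empty : ∀ C S → IsComponent (H ∖ F) C S → (C , S) ∉ₗ J → Empty S
    others-empty C S comp CS∉J (k , k∈S)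
      with traversed-edge-meets-vertices w (covers (select-index (E H) (∁ F) k))
    ... | x , x∈w , x∈k = CS∉J (subst (_∈ₗ J) (sym (component-unique comp x∈C)) (vertex∈J x∈w))
      where
      x∈C : x ∈ C
      x∈C = component-edge⊆ comp k∈S (subst (x ∈_) (sym (edge-∖ k)) x∈k)

  tourComponents⇒tour : IsMinimalEdgeCut H F → ∃ TourComponents → EulerTour H
  tourComponents⇒tour mc (J@(_ ∷ _) , _ , comps , _ , _ , tourJ , others-empty) =
    tour-unrestrict H U U⊆V meets tourJ
    where
    U = ⋃ (map proj₁ J)
    ⊆U : ∀ {c} → c ∈ₗ J → proj₁ c ⊆ U
    ⊆U = ∈ₗ⇒⊆⋃ ∘ ∈-map⁺ proj₁
    U⊆V : U ⊆ V H
    U⊆V x∈U with x∈⋃⁻ (map proj₁ J) x∈U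
    ... | _ , C∈ , x∈C with ∈-map⁻ proj₁ C∈
    ...   | _ , c∈J , refl = component⊆V (All.lookup comps c∈J) x∈C
    meets : ∀ i → Nonempty (edge H i ∩ U)
    meets i with i ∈? F
    ... | yes i∈F with minimal-cut-meets-components mc (All.lookup comps (here refl)) i∈F
    ...   | x , x∈i∩C with x∈p∩q⁻ _ _ x∈i∩C
    ...     | x∈i , x∈C = x , x∈p∩q⁺ (x∈i , ⊆U (here refl) x∈C)
    meets i | no i∉F with noEmpty i
    ... | y , y∈i with DecMembership._∈?_ _≟ᶜ_ (component y) J
    ...   | yes y∈J = y , x∈p∩q⁺ (y∈i , ⊆U y∈J (x∈component y))
    ...   | no  y∉J =
      ⊥-elim (others-empty _ _ (component-isComponent (proj₂ wf i y∈i)) y∉J (component-edges-nonempty i∉F y∈i))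

theorem5p3 : ∀ {n} (H : Hypergraph n) (F : Subset (length (E H))) →
    WellFormed H → NoEmptyEdge H → Connected H → IsMinimalEdgeCut H F →
    EulerTour H ⇔
      (∃ λ (J : List (Σ (Subset n) λ C → Subset (length (E (H ∖ F))))) →
        Unique J ×
        All (λ c → IsComponent (H ∖ F) (proj₁ c) (proj₂ c)) J ×
        1 ≤ length J × length J ≤ ∣ F ∣ ×
        EulerTour (H [ ⋃ (map proj₁ J) ]) ×
        (∀ C S → IsComponent (H ∖ F) C S → (C , S) ∉ₗ J → Empty S))
theorem5p3 H F wf noEmpty conn minimal =
  mk⇔ (tour⇒tourComponents conn (proj₁ minimal)) (tourComponents⇒tour minimal)
  where open CutComponents H F wf noEmpty
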